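{- Let $\mathcal{V}$ be a finite ground set, $1\le K\le|\mathcal{V}|$, and $F:2^{\mathcal{V}}\to\mathbb{R}_{\ge0}$ a non-negative nondecreasing set function with $F(\emptyset)=0$, with submodularity ratio (or greedy submodularity ratio) $\gamma\in(0,1]$ and curvature (or greedy curvature) $\alpha\in[0,1]$. Let $S^0=\emptyset$, $S^t=\{j_1,\dots,j_t\}$ ($t=1,\dots,K$) be the successive sets of the Greedy algorithm and $\rho_t:=\rho_{j_t}(S^{t-1})$. Then for every $\Omega\subseteq\mathcal{V}$ with $|\Omega|=K$ and every $t\in\{0,\dots,K-1\}$, with $w^t:=|S^t\cap\Omega|$, $$\alpha\sum_{i:\,j_i\in S^t\setminus\Omega}\rho_i+\sum_{i:\,j_i\in S^t\cap\Omega}\rho_i+\gamma^{ -1}(K-w^t)\rho_{t+1}\ \ge\ F(\Omega).$$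
   Context: For $\Omega,S\subseteq\mathcal{V}$, $\rho_\Omega(S):=F(\Omega\cup S)-F(S)$, $\rho_v(S):=\rho_{\{v\}}(S)$. Greedy: $S^0=\emptyset$; for $t=1,\dots,K$ choose $j_t\in\arg\max_{v\notin S^{t-1}}\rho_v(S^{t-1})$ and set $S^t=S^{t-1}\cup\{j_t\}$. Submodularity ratio $\gamma$: largest scalar with $\sum_{\omega\in\Omega\setminus S}\rho_\omega(S)\ge\gamma\rho_\Omega(S)$ for all $\Omega,S\subseteq\mathcal{V}$; greedy submodularity ratio $\gamma^G$: largest scalar with $\sum_{\omega\in\Omega\setminus S^t}\rho_\omega(S^t)\ge\gamma^G\rho_\Omega(S^t)$ for all $|\Omega|=K$, $t=0,\dots,K-1$. Curvature $\alpha$: smallest scalar with $\rho_i(S\setminus\{i\}\cup\Omega)\ge(1-\alpha)\rho_i(S\setminus\{i\})$ for all $\Omega,S\subseteq\mathcal{V}$, $i\in S\setminus\Omega$; greedy curvature $\alpha^G$: smallest scalar $\ge0$ with $\rho_{j_i}(S^{i-1}\cup\Omega)\ge(1-\alpha^G)\rho_{j_i}(S^{i-1})$ for all $|\Omega|=K$ and $i$ with $j_i\in S^{K-1}\setminus\Omega$. -}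

module Defs where

open import Level using (0ℓ) renaming (suc to lsuc)
open import Data.Nat as ℕ using (ℕ; zero; suc)
open import Data.Bool using (Bool; true; false; if_then_else_)
open import Data.Fin using (Fin)
open import Data.Vec using (Vec; []; _∷_; lookup)
open import Data.Fin.Subset
  using (Subset; _∪_; _∩_; _─_; ⁅_⁆; _∈_; _∉_; _⊆_; ∣_∣)
  renaming (⊥ to ∅)
open import Data.Product using (_×_)
open import Relation.Nullary using (¬_)
open import Relation.Binary.PropositionalEquality using (_≡_)
open import Algebra.Bundles using (CommutativeRing)
open import Relation.Binary.Structures using (IsTotalOrder)

-- Ordered fields (the standard library has no real numbers; the
-- statement is made for an arbitrary ordered field, ℝ being one).

record OrderedField : Set₁ where
  field
    commutativeRing : CommutativeRing 0ℓ 0ℓ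
  open CommutativeRing commutativeRing public
  infix 4 _≤_
  infix 8 _⁻¹
  field
    _≤_          : Carrier → Carrier → Set
    isTotalOrder : IsTotalOrder _≈_ _≤_
    +-mono-≤     : ∀ {x y} z → x ≤ y → x + z ≤ y + z
    *-nonneg     : ∀ {x y} → 0# ≤ x → 0# ≤ y → 0# ≤ x * y
    1≉0          : ¬ (1# ≈ 0#)
    _⁻¹          : Carrier → Carrier
    ⁻¹-inverse   : ∀ x → ¬ (x ≈ 0#) → x * (x ⁻¹) ≈ 1#

  infix 4 _<_
  _<_ : Carrier → Carrier → Set
  x < y = x ≤ y × ¬ (x ≈ y)

  fromℕ : ℕ → Carrier
  fromℕ zero    = 0#
  fromℕ (suc m) = 1# + fromℕ m

-- Set functions on the ground set V = Fin n, with a Greedy sequence.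
-- j : ℕ → Fin n lists the greedy choices j₁, j₂, … (j 0 is unused, and
-- only j 1 … j K matter).

module Setup (OF : OrderedField) {n : ℕ}
             (F : Subset n → OrderedField.Carrier OF)
             (K : ℕ) (j : ℕ → Fin n) where
  open OrderedField OF

  sumOver : ∀ {m} → Subset m → (Fin m → Carrier) → Carrier
  sumOver []            f = 0#
  sumOver (b ∷ A) f =
    (if b then f Fin.zero else 0#) + sumOver A (λ i → f (Fin.suc i))

  ρ : Subset n → Subset n → Carrier
  ρ Ω S = F (Ω ∪ S) - F S

  ρv : Fin n → Subset n → Carrier
  ρv v S = ρ ⁅ v ⁆ S

  S : ℕ → Subset n
  S zero    = ∅
  S (suc t) = S t ∪ ⁅ j (suc t) ⁆

  ρseq : ℕ → Carrier
  ρseq zero    = 0#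
  ρseq (suc s) = ρv (j (suc s)) (S s)

  sumIdx : Subset n → ℕ → Carrier
  sumIdx X zero    = 0#
  sumIdx X (suc t) =
    sumIdx X t + (if lookup X (j (suc t)) then ρseq (suc t) else 0#)

  NonNegative : Set
  NonNegative = ∀ A → 0# ≤ F A

  Nondecreasing : Set
  Nondecreasing = ∀ A B → A ⊆ B → F A ≤ F B

  Normalized : Set
  Normalized = F ∅ ≈ 0#

  IsGreedy : Set
  IsGreedy = ∀ s → s ℕ.< K →
    (j (suc s) ∉ S s) ×
    (∀ v → v ∉ S s → ρv v (S s) ≤ ρv (j (suc s)) (S s))

  SubmodBound : Carrier → Set
  SubmodBound γ = ∀ Ω A →
    γ * ρ Ω A ≤ sumOver (Ω ─ A) (λ ω → ρv ω A)

  IsSubmodularityRatio : Carrier → Set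
  IsSubmodularityRatio γ =
    SubmodBound γ × (∀ γ' → SubmodBound γ' → γ' ≤ γ)

  GreedySubmodBound : Carrier → Set
  GreedySubmodBound γ = ∀ Ω → ∣ Ω ∣ ≡ K → ∀ t → t ℕ.< K →
    γ * ρ Ω (S t) ≤ sumOver (Ω ─ S t) (λ ω → ρv ω (S t))

  IsGreedySubmodularityRatio : Carrier → Set
  IsGreedySubmodularityRatio γ =
    GreedySubmodBound γ × (∀ γ' → GreedySubmodBound γ' → γ' ≤ γ)

  CurvBound : Carrier → Set
  CurvBound α = ∀ Ω A i → i ∈ A → i ∉ Ω →
    (1# - α) * ρv i (A ─ ⁅ i ⁆) ≤ ρv i ((A ─ ⁅ i ⁆) ∪ Ω)

  IsCurvature : Carrier → Set
  IsCurvature α = CurvBound α × (∀ α' → CurvBound α' → α ≤ α')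

  -- greedy curvature: the smallest such scalar ≥ 0
  -- (i ranges over the indices with j_i ∈ S^{K-1}, i.e. i = s+1 ≤ K-1)
  GreedyCurvBound : Carrier → Set
  GreedyCurvBound α = 0# ≤ α × (∀ Ω → ∣ Ω ∣ ≡ K → ∀ s → suc s ℕ.< K →
    j (suc s) ∉ Ω →
    (1# - α) * ρv (j (suc s)) (S s) ≤ ρv (j (suc s)) (S s ∪ Ω))

  IsGreedyCurvature : Carrier → Set
  IsGreedyCurvature α =
    GreedyCurvBound α × (∀ α' → GreedyCurvBound α' → α ≤ α')

module Submission where

-- Write x = j_{m+1},
-- r_{m+1} = ρ_{m+1} and call ρ_Ω(S^m) the residual gain of Ω at step m.
-- Going from S^m to S^{m+1} the residual gain drops by
--   r_{m+1} − ρ_x(S^m ∪ Ω)            (exchange identity),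
-- which is r_{m+1} when x ∈ Ω (then ρ_x(S^m ∪ Ω) = 0) and at most
-- α·r_{m+1} when x ∉ Ω (curvature).  Summing these drops over
-- m = 0,…,t−1, starting from ρ_Ω(∅) = F(Ω), gives the invariant
--   F(Ω) ≤ ρ_Ω(S^t) + α·Σ_{j_i ∈ S^t∖Ω} ρ_i + Σ_{j_i ∈ S^t∩Ω} ρ_i,
-- and the index sums may run up to K since j_i ∉ S^t for i > t.
-- Finally the submodularity ratio and the greedy choice of j_{t+1} give
--   γ·ρ_Ω(S^t) ≤ Σ_{ω ∈ Ω∖S^t} ρ_ω(S^t) ≤ (K − w^t)·ρ_{t+1}.

open import Defs
open import Level using (0ℓ)
open import Data.Nat as ℕ using (ℕ; zero; suc)
import Data.Nat.Properties as ℕP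
open import Data.Bool using (true; false; not; _∧_; if_then_else_)
open import Data.Fin using (Fin)
open import Data.Vec using ([]; _∷_; lookup; here; there)
open import Data.Vec.Properties using (lookup-zipWith; []=⇒lookup; lookup⇒[]=)
open import Data.Fin.Subset
  using (Subset; _∪_; _∩_; _─_; ⁅_⁆; _∈_; _∉_; _⊆_; ∣_∣; inside; outside)
  renaming (⊥ to ∅)
open import Data.Fin.Subset.Properties
  using (⊆-antisym; p⊆p∪q; q⊆p∪q; x∈p∪q⁻; x∈⁅x⁆; x∈⁅y⁆⇒x≡y;
         p─q⊆p; p∩q⊆p; ∪-comm; ∪-assoc; ∪-identityʳ; p─⊥≡p)
open import Data.Sum using (_⊎_; inj₁; inj₂)
open import Data.Product using (_,_; proj₁; proj₂)
open import Data.Maybe using (nothing)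
open import Relation.Nullary using (contradiction)
open import Relation.Binary.Bundles using (Poset)
open import Relation.Binary.Structures using (IsTotalOrder)
open import Relation.Binary.PropositionalEquality as P
  using (_≡_; cong; subst)
open import Algebra.Properties.Ring using (-‿distribˡ-*; -‿involutive)
open import Tactic.RingSolver using (solve-∀)
open import Tactic.RingSolver.Core.AlmostCommutativeRing
  using (AlmostCommutativeRing; fromCommutativeRing)

module SubsetFacts where

  ∉⇒lookup≡outside : ∀ {m} {x : Fin m} (p : Subset m) →
                     x ∉ p → lookup p x ≡ outside
  ∉⇒lookup≡outside {x = x} p x∉p with lookup p x in eq
  ... | outside = P.refl
  ... | inside  = contradiction (lookup⇒[]= x p eq) x∉p

  lookup≡outside⇒∉ : ∀ {m} {x : Fin m} (p : Subset m) →
                     lookup p x ≡ outside → x ∉ p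
  lookup≡outside⇒∉ p eq x∈p = contradiction (P.trans (P.sym ([]=⇒lookup x∈p)) eq) λ ()

  lookup-─ : ∀ {m} (p q : Subset m) x →
             lookup (p ─ q) x ≡ not (lookup q x) ∧ lookup p x
  lookup-─ (_ ∷ _) (inside  ∷ _) Fin.zero    = P.refl
  lookup-─ (_ ∷ _) (outside ∷ _) Fin.zero    = P.refl
  lookup-─ (_ ∷ p) (_       ∷ q) (Fin.suc x) = lookup-─ p q x

  x∈p─q⇒x∉q : ∀ {m} {x : Fin m} (p q : Subset m) → x ∈ p ─ q → x ∉ q
  x∈p─q⇒x∉q (_ ∷ p) (_ ∷ q) (there x∈p─q) (there x∈q) = x∈p─q⇒x∉q p q x∈p─q x∈q
  x∈p─q⇒x∉q (_ ∷ p) (inside ∷ q) () here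

  ⊆⇒∪≡ : ∀ {m} {p q : Subset m} → p ⊆ q → p ∪ q ≡ q
  ⊆⇒∪≡ {p = p} {q} p⊆q = ⊆-antisym absorb (q⊆p∪q p q)
    where
    absorb : p ∪ q ⊆ q
    absorb x∈ with x∈p∪q⁻ p q x∈
    ... | inj₁ x∈p = p⊆q x∈p
    ... | inj₂ x∈q = x∈q

  ∈⇒⁅⁆∪≡ : ∀ {m} {x : Fin m} {p : Subset m} → x ∈ p → ⁅ x ⁆ ∪ p ≡ p
  ∈⇒⁅⁆∪≡ {x = x} x∈p = ⊆⇒∪≡ (λ y∈⁅x⁆ → subst (_∈ _) (P.sym (x∈⁅y⁆⇒x≡y x y∈⁅x⁆)) x∈p)

  insert-remove : ∀ {m} (p : Subset m) x → x ∉ p → (p ∪ ⁅ x ⁆) ─ ⁅ x ⁆ ≡ p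
  insert-remove (inside  ∷ p) Fin.zero    x∉p = contradiction here x∉p
  insert-remove (outside ∷ p) Fin.zero    _   =
    cong (outside ∷_) (P.trans (cong (_─ ∅) (∪-identityʳ p)) (p─⊥≡p p))
  insert-remove (inside  ∷ p) (Fin.suc x) x∉p =
    cong (inside ∷_) (insert-remove p x (λ x∈p → x∉p (there x∈p)))
  insert-remove (outside ∷ p) (Fin.suc x) x∉p =
    cong (outside ∷_) (insert-remove p x (λ x∈p → x∉p (there x∈p)))

  ∣─∣+∣∩∣ : ∀ {m} (Ω A : Subset m) → ∣ Ω ─ A ∣ ℕ.+ ∣ A ∩ Ω ∣ ≡ ∣ Ω ∣
  ∣─∣+∣∩∣ []            []            = P.refl
  ∣─∣+∣∩∣ (inside  ∷ Ω) (inside  ∷ A) =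
    P.trans (ℕP.+-suc _ _) (cong suc (∣─∣+∣∩∣ Ω A))
  ∣─∣+∣∩∣ (inside  ∷ Ω) (outside ∷ A) = cong suc (∣─∣+∣∩∣ Ω A)
  ∣─∣+∣∩∣ (outside ∷ Ω) (inside  ∷ A) = ∣─∣+∣∩∣ Ω A
  ∣─∣+∣∩∣ (outside ∷ Ω) (outside ∷ A) = ∣─∣+∣∩∣ Ω A

  ∣─∣≡∣∣∸∣∩∣ : ∀ {m} (Ω A : Subset m) → ∣ Ω ─ A ∣ ≡ ∣ Ω ∣ ℕ.∸ ∣ A ∩ Ω ∣
  ∣─∣≡∣∣∸∣∩∣ Ω A = P.trans (P.sym (ℕP.m+n∸n≡m ∣ Ω ─ A ∣ ∣ A ∩ Ω ∣))
                          (cong (ℕ._∸ ∣ A ∩ Ω ∣) (∣─∣+∣∩∣ Ω A))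

open SubsetFacts

module OrderedFieldFacts (OF : OrderedField) where

  private
    ACR : AlmostCommutativeRing 0ℓ 0ℓ
    ACR = fromCommutativeRing (OrderedField.commutativeRing OF) (λ _ → nothing)

  module Identities where
    open AlmostCommutativeRing ACR
    swap : ∀ x d c → x + (d + c) ≈ (x + c) + d
    swap = solve-∀ ACR
    regroup : ∀ a A B u v → a * (A + u) + (B + v) ≈ (a * A + B) + (a * u + v)
    regroup = solve-∀ ACR

  open OrderedField OF
  module TO = IsTotalOrder isTotalOrder

  poset : Poset 0ℓ 0ℓ 0ℓ
  poset = record { isPartialOrder = TO.isPartialOrder }
  open import Relation.Binary.Reasoning.PartialOrder poset public
  open import Algebra.Properties.Group +-group
    using (ε⁻¹≈ε)
    renaming (//-rightDividesʳ to add-sub; //-rightDividesˡ to sub-add)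

  sub-zero : ∀ {x z} → z ≈ 0# → x - z ≈ x
  sub-zero {x} z≈0 = trans (+-congˡ (trans (-‿cong z≈0) ε⁻¹≈ε)) (+-identityʳ x)

  sub-chain : ∀ c d b → (c - d) + (d - b) ≈ c - b
  sub-chain c d b = trans (sym (+-assoc (c - d) d (- b))) (+-congʳ (sub-add d c))

  shift : ∀ x d c → (x + (d + c)) - d ≈ x + c
  shift x d c = trans (+-congʳ (Identities.swap x d c)) (add-sub d (x + c))

  split-one : ∀ a r → r ≈ (1# - a) * r + a * r
  split-one a r = sym (trans (sym (distribʳ r (1# - a) a))
                             (trans (*-congʳ (sub-add a 1#)) (*-identityˡ r)))

  ≤-reflexive : ∀ {x y} → x ≈ y → x ≤ y
  ≤-reflexive = TO.reflexive

  +-monoʳ-≤ : ∀ {x y} z → x ≤ y → z + x ≤ z + y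
  +-monoʳ-≤ {x} {y} z x≤y = begin
    z + x ≈⟨ +-comm z x ⟩ x + z ≤⟨ +-mono-≤ z x≤y ⟩ y + z ≈⟨ +-comm y z ⟩ z + y ∎

  *-monoˡ-≤ : ∀ {x y} c → 0# ≤ c → x ≤ y → c * x ≤ c * y
  *-monoˡ-≤ {x} {y} c 0≤c x≤y = begin
    c * x                     ≈⟨ sym (+-identityˡ _) ⟩
    0# + c * x                ≤⟨ +-mono-≤ (c * x) (*-nonneg 0≤c 0≤y-x) ⟩
    c * (y - x) + c * x       ≈⟨ sym (distribˡ c (y - x) x) ⟩
    c * ((y - x) + x)         ≈⟨ *-congˡ (sub-add x y) ⟩
    c * y                     ∎
    where
    0≤y-x : 0# ≤ y - x
    0≤y-x = begin 0# ≈⟨ sym (-‿inverseʳ x) ⟩ x - x ≤⟨ +-mono-≤ (- x) x≤y ⟩ y - x ∎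

  -- 0 ≤ 1, since otherwise 0 ≤ −1 and hence 0 ≤ (−1)(−1) = 1.
  0≤1 : 0# ≤ 1#
  0≤1 with TO.total 0# 1#
  ... | inj₁ le   = le
  ... | inj₂ 1≤0 = contradiction (TO.antisym 1≤0 0≤1') 1≉0
    where
    0≤-1 : 0# ≤ - 1#
    0≤-1 = begin
      0# ≈⟨ sym (-‿inverseʳ 1#) ⟩ 1# - 1# ≤⟨ +-mono-≤ (- 1#) 1≤0 ⟩
      0# - 1# ≈⟨ +-identityˡ _ ⟩ - 1# ∎
    0≤1' : 0# ≤ 1#
    0≤1' = begin
      0#          ≤⟨ *-nonneg 0≤-1 0≤-1 ⟩
      - 1# * - 1# ≈⟨ sym (-‿distribˡ-* ring 1# (- 1#)) ⟩
      - (1# * - 1#) ≈⟨ -‿cong (*-identityˡ _) ⟩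
      - - 1#      ≈⟨ -‿involutive ring 1# ⟩
      1#          ∎

  ⁻¹-nonneg : ∀ {g} → 0# < g → 0# ≤ g ⁻¹
  ⁻¹-nonneg {g} (0≤g , 0≉g) with TO.total 0# (g ⁻¹)
  ... | inj₁ 0≤g⁻¹ = 0≤g⁻¹
  ... | inj₂ g⁻¹≤0 = contradiction (TO.antisym 1≤0 0≤1) 1≉0
    where
    1≤0 : 1# ≤ 0#
    1≤0 = begin
      1#       ≈⟨ sym (⁻¹-inverse g (λ g≈0 → 0≉g (sym g≈0))) ⟩
      g * g ⁻¹ ≤⟨ *-monoˡ-≤ g 0≤g g⁻¹≤0 ⟩
      g * 0#   ≈⟨ zeroʳ g ⟩
      0#       ∎

  divide-≤ : ∀ {g x y} → 0# < g → g * x ≤ y → x ≤ g ⁻¹ * y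
  divide-≤ {g} {x} {y} 0<g gx≤y = begin
    x              ≈⟨ sym (*-identityˡ x) ⟩
    1# * x         ≈⟨ *-congʳ (sym (trans (*-comm _ g) (⁻¹-inverse g (λ g≈0 → proj₂ 0<g (sym g≈0))))) ⟩
    g ⁻¹ * g * x   ≈⟨ *-assoc _ g x ⟩
    g ⁻¹ * (g * x) ≤⟨ *-monoˡ-≤ (g ⁻¹) (⁻¹-nonneg 0<g) gx≤y ⟩
    g ⁻¹ * y       ∎

  cancel-≤ : ∀ {p p' d r c} → p + d ≈ p' + r → r ≤ d + c → p ≤ p' + c
  cancel-≤ {p} {p'} {d} {r} {c} eq r≤d+c = begin
    p                  ≈⟨ sym (add-sub d p) ⟩
    (p + d) - d        ≈⟨ +-congʳ eq ⟩
    (p' + r) - d       ≤⟨ +-mono-≤ (- d) (+-monoʳ-≤ p' r≤d+c) ⟩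
    (p' + (d + c)) - d ≈⟨ shift p' d c ⟩
    p' + c             ∎

  curvature-≤ : ∀ {a r d} → (1# - a) * r ≤ d → r ≤ d + a * r
  curvature-≤ {a} {r} {d} h = begin
    r                    ≈⟨ split-one a r ⟩
    (1# - a) * r + a * r ≤⟨ +-mono-≤ (a * r) h ⟩
    d + a * r            ∎

module GreedyBound (OF : OrderedField) {n : ℕ}
                   (F : Subset n → OrderedField.Carrier OF)
                   (K : ℕ) (j : ℕ → Fin n) where
  open OrderedField OF hiding (zero)
  open OrderedFieldFacts OF
  open Setup OF F K j

  -- Exchange identity: passing from A to A ∪ {x} lowers the residual
  -- gain of Ω by ρ_x(A) − ρ_x(A ∪ Ω).
  exchange : ∀ Ω A x → ρ Ω A + ρv x (A ∪ Ω) ≈ ρ Ω (A ∪ ⁅ x ⁆) + ρv x A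
  exchange Ω A x = begin-equality
    (F (Ω ∪ A) - F A) + (F (⁅ x ⁆ ∪ (A ∪ Ω)) - F (A ∪ Ω))
      ≈⟨ +-cong (+-congʳ (reflexive (cong F (∪-comm Ω A))))
                (+-congʳ (reflexive (cong F (x∪[A∪Ω]≡Ω∪[A∪x])))) ⟩
    (F (A ∪ Ω) - F A) + (F (Ω ∪ (A ∪ ⁅ x ⁆)) - F (A ∪ Ω))
      ≈⟨ trans (+-comm _ _) (sub-chain _ _ _) ⟩
    F (Ω ∪ (A ∪ ⁅ x ⁆)) - F A
      ≈⟨ sym (sub-chain _ (F (A ∪ ⁅ x ⁆)) _) ⟩
    (F (Ω ∪ (A ∪ ⁅ x ⁆)) - F (A ∪ ⁅ x ⁆)) + (F (A ∪ ⁅ x ⁆) - F A)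
      ≈⟨ +-congˡ (+-congʳ (reflexive (cong F (∪-comm A ⁅ x ⁆)))) ⟩
    (F (Ω ∪ (A ∪ ⁅ x ⁆)) - F (A ∪ ⁅ x ⁆)) + (F (⁅ x ⁆ ∪ A) - F A) ∎
    where
    x∪[A∪Ω]≡Ω∪[A∪x] : ⁅ x ⁆ ∪ (A ∪ Ω) ≡ Ω ∪ (A ∪ ⁅ x ⁆)
    x∪[A∪Ω]≡Ω∪[A∪x] = P.trans (∪-comm ⁅ x ⁆ (A ∪ Ω))
      (P.trans (cong (_∪ ⁅ x ⁆) (∪-comm A Ω)) (∪-assoc Ω A ⁅ x ⁆))

  ρv-absorbed : ∀ {x B} → x ∈ B → ρv x B ≈ 0#
  ρv-absorbed {x} {B} x∈B =
    trans (+-congʳ (reflexive (cong F (∈⇒⁅⁆∪≡ x∈B)))) (-‿inverseʳ (F B))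

  sumOver-≤ : ∀ {m} (X : Subset m) (f : Fin m → Carrier) c →
              (∀ i → i ∈ X → f i ≤ c) → sumOver X f ≤ fromℕ ∣ X ∣ * c
  sumOver-≤ []            f c f≤c = ≤-reflexive (sym (zeroˡ c))
  sumOver-≤ (inside ∷ X)  f c f≤c = begin
    f Fin.zero + sumOver X (λ i → f (Fin.suc i))
      ≤⟨ TO.trans (+-mono-≤ _ (f≤c Fin.zero here))
                  (+-monoʳ-≤ c (sumOver-≤ X _ c (λ i i∈X → f≤c (Fin.suc i) (there i∈X)))) ⟩
    c + fromℕ ∣ X ∣ * c
      ≈⟨ sym (trans (distribʳ c 1# (fromℕ ∣ X ∣)) (+-congʳ (*-identityˡ c))) ⟩
    (1# + fromℕ ∣ X ∣) * c ∎
  sumOver-≤ (outside ∷ X) f c f≤c = TO.trans (≤-reflexive (+-identityˡ _))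
    (sumOver-≤ X _ c (λ i i∈X → f≤c (Fin.suc i) (there i∈X)))

  S-mono : ∀ {m m'} → m ℕ.≤ m' → S m ⊆ S m'
  S-mono {m' = zero}   ℕ.z≤n x∈ = x∈
  S-mono {m' = suc m'} m≤1+m' x∈ with ℕP.m≤n⇒m<n∨m≡n m≤1+m'
  ... | inj₁ (ℕ.s≤s m≤m') = p⊆p∪q ⁅ j (suc m') ⁆ (S-mono m≤m' x∈)
  ... | inj₂ P.refl       = x∈

  j∈S : ∀ {i t} → i ℕ.< t → j (suc i) ∈ S t
  j∈S {i} i<t = S-mono i<t (q⊆p∪q (S i) ⁅ j (suc i) ⁆ (x∈⁅x⁆ (j (suc i))))

  sumIdx-stable : ∀ X t m → t ℕ.≤ m →
    (∀ i → t ℕ.≤ i → i ℕ.< m → j (suc i) ∉ X) → sumIdx X m ≈ sumIdx X t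
  sumIdx-stable X t zero    ℕ.z≤n _ = refl
  sumIdx-stable X t (suc m) t≤1+m j∉X with ℕP.m≤n⇒m<n∨m≡n t≤1+m
  ... | inj₂ P.refl = refl
  ... | inj₁ (ℕ.s≤s t≤m)
    rewrite ∉⇒lookup≡outside X (j∉X m t≤m ℕP.≤-refl) =
    trans (+-identityʳ _)
          (sumIdx-stable X t m t≤m (λ i t≤i i<m → j∉X i t≤i (ℕP.m≤n⇒m≤1+n i<m)))

  module Greedy (greedy : IsGreedy) where

    j∉S : ∀ {t i} → t ℕ.≤ i → i ℕ.< K → j (suc i) ∉ S t
    j∉S t≤i i<K j∈St = proj₁ (greedy _ i<K) (S-mono t≤i j∈St)

    module Target (α : Carrier) (curvature : IsCurvature α ⊎ IsGreedyCurvature α)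
             (Ω : Subset n) (∣Ω∣≡K : ∣ Ω ∣ ≡ K) (t : ℕ) (t<K : t ℕ.< K) where

      W : ℕ → Carrier
      W m = α * sumIdx (S t ─ Ω) m + sumIdx (S t ∩ Ω) m

      charge : ℕ → Carrier
      charge m = if lookup Ω (j (suc m)) then ρseq (suc m) else α * ρseq (suc m)

      -- For m < t, j_{m+1} ∈ S^t lies in exactly one of S^t∖Ω and S^t∩Ω,
      -- according to whether it belongs to Ω.
      W-step : ∀ m → m ℕ.< t → W (suc m) ≈ W m + charge m
      W-step m m<t = trans (Identities.regroup α _ _ _ _) (+-congˡ (step (lookup Ω x) P.refl))
        where
        x : Fin n
        x = j (suc m)
        r : Carrier
        r = ρseq (suc m)
        x∈St : lookup (S t) x ≡ true
        x∈St = []=⇒lookup (j∈S m<t)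
        step : ∀ b → lookup Ω x ≡ b →
               α * (if lookup (S t ─ Ω) x then r else 0#)
                 + (if lookup (S t ∩ Ω) x then r else 0#)
               ≈ (if b then r else α * r)
        step b eq rewrite lookup-─ (S t) Ω x | lookup-zipWith _∧_ x (S t) Ω | x∈St | eq
          with b
        ... | true  = trans (+-congʳ (zeroʳ α)) (+-identityˡ r)
        ... | false = +-identityʳ (α * r)

      curvature-step : ∀ m → suc m ℕ.< K → j (suc m) ∉ Ω →
                       (1# - α) * ρseq (suc m) ≤ ρv (j (suc m)) (S m ∪ Ω)
      curvature-step m 1+m<K x∉Ω = from curvature
        where
        x : Fin n
        x = j (suc m)
        from : IsCurvature α ⊎ IsGreedyCurvature α →
               (1# - α) * ρseq (suc m) ≤ ρv x (S m ∪ Ω)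
        from (inj₂ ((_ , bound) , _)) = bound Ω ∣Ω∣≡K m 1+m<K x∉Ω
        from (inj₁ (bound , _)) =
          subst (λ A → (1# - α) * ρv x A ≤ ρv x (A ∪ Ω))
                (insert-remove (S m) x (j∉S ℕP.≤-refl (ℕP.<⇒≤ 1+m<K)))
                (bound Ω (S (suc m)) x (j∈S ℕP.≤-refl) x∉Ω)

      residual-step : ∀ m → suc m ℕ.< K → ρ Ω (S m) ≤ ρ Ω (S (suc m)) + charge m
      residual-step m 1+m<K = cancel-≤ (exchange Ω (S m) x) (gain≤ (lookup Ω x) P.refl)
        where
        x : Fin n
        x = j (suc m)
        r : Carrier
        r = ρseq (suc m)
        gain≤ : ∀ b → lookup Ω x ≡ b →
                r ≤ ρv x (S m ∪ Ω) + (if b then r else α * r)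
        gain≤ true  x∈Ω = begin
          r                       ≈⟨ sym (+-identityˡ r) ⟩
          0# + r                  ≈⟨ +-congʳ (sym (ρv-absorbed x∈S∪Ω)) ⟩
          ρv x (S m ∪ Ω) + r      ∎
          where
          x∈S∪Ω : x ∈ S m ∪ Ω
          x∈S∪Ω = q⊆p∪q (S m) Ω (lookup⇒[]= x Ω x∈Ω)
        gain≤ false x∉Ω =
          curvature-≤ (curvature-step m 1+m<K (lookup≡outside⇒∉ Ω x∉Ω))

      invariant : ∀ m → m ℕ.≤ t → Normalized → F Ω ≤ ρ Ω (S m) + W m
      invariant zero    _     normalized = ≤-reflexive (begin-equality
        F Ω                             ≈⟨ reflexive (cong F (P.sym (∪-identityʳ Ω))) ⟩
        F (Ω ∪ ∅)                       ≈⟨ sym (sub-zero normalized) ⟩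
        F (Ω ∪ ∅) - F ∅                 ≈⟨ sym (+-identityʳ _) ⟩
        ρ Ω ∅ + 0#                      ≈⟨ +-congˡ (sym (trans (+-identityʳ _) (zeroʳ α))) ⟩
        ρ Ω ∅ + W zero                  ∎)
      invariant (suc m) 1+m≤t normalized = begin
        F Ω                                     ≤⟨ invariant m (ℕP.<⇒≤ 1+m≤t) normalized ⟩
        ρ Ω (S m) + W m                         ≤⟨ +-mono-≤ (W m) (residual-step m (ℕP.≤-<-trans 1+m≤t t<K)) ⟩
        (ρ Ω (S (suc m)) + charge m) + W m      ≈⟨ +-assoc _ _ _ ⟩
        ρ Ω (S (suc m)) + (charge m + W m)      ≈⟨ +-congˡ (trans (+-comm _ _) (sym (W-step m 1+m≤t))) ⟩
        ρ Ω (S (suc m)) + W (suc m)             ∎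

      -- Submodularity ratio plus the greedy choice of j_{t+1}.
      residual-bound : ∀ γ → IsSubmodularityRatio γ ⊎ IsGreedySubmodularityRatio γ → 0# < γ →
        ρ Ω (S t) ≤ γ ⁻¹ * (fromℕ (K ℕ.∸ ∣ S t ∩ Ω ∣) * ρseq (suc t))
      residual-bound γ ratio 0<γ = divide-≤ 0<γ (begin
        γ * ρ Ω (S t)                              ≤⟨ ratio-bound ratio ⟩
        sumOver (Ω ─ S t) (λ ω → ρv ω (S t))       ≤⟨ sumOver-≤ (Ω ─ S t) _ _ greedy-max ⟩
        fromℕ ∣ Ω ─ S t ∣ * ρseq (suc t)            ≡⟨ cong (λ k → fromℕ k * ρseq (suc t)) ∣Ω─St∣ ⟩
        fromℕ (K ℕ.∸ ∣ S t ∩ Ω ∣) * ρseq (suc t)   ∎)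
        where
        ratio-bound : IsSubmodularityRatio γ ⊎ IsGreedySubmodularityRatio γ →
                      γ * ρ Ω (S t) ≤ sumOver (Ω ─ S t) (λ ω → ρv ω (S t))
        ratio-bound (inj₁ (bound , _)) = bound Ω (S t)
        ratio-bound (inj₂ (bound , _)) = bound Ω ∣Ω∣≡K t t<K
        greedy-max : ∀ ω → ω ∈ Ω ─ S t → ρv ω (S t) ≤ ρseq (suc t)
        greedy-max ω ω∈ = proj₂ (greedy t t<K) ω λ ω∈St →
          x∈p─q⇒x∉q Ω (S t) ω∈ ω∈St
        ∣Ω─St∣ : ∣ Ω ─ S t ∣ ≡ K ℕ.∸ ∣ S t ∩ Ω ∣
        ∣Ω─St∣ = P.trans (∣─∣≡∣∣∸∣∩∣ Ω (S t)) (cong (ℕ._∸ ∣ S t ∩ Ω ∣) ∣Ω∣≡K)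

      -- Greedy elements after step t are not in S^t, so W t = W K.
      W-frozen : W t ≈ α * sumIdx (S t ─ Ω) K + sumIdx (S t ∩ Ω) K
      W-frozen = sym (+-cong (*-congˡ (frozen (S t ─ Ω) (p─q⊆p (S t) Ω)))
                             (frozen (S t ∩ Ω) (p∩q⊆p (S t) Ω)))
        where
        frozen : ∀ X → X ⊆ S t → sumIdx X K ≈ sumIdx X t
        frozen X X⊆St = sumIdx-stable X t K (ℕP.<⇒≤ t<K)
                          (λ i t≤i i<K x∈X → j∉S t≤i i<K (X⊆St x∈X))

lemma1 : (OF : OrderedField) → let open OrderedField OF in
    (n K : ℕ) (F : Subset n → Carrier) (j : ℕ → Fin n) (γ α : Carrier) →
    let open Setup OF F K j in
    1 ℕ.≤ K → K ℕ.≤ n →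
    NonNegative → Nondecreasing → Normalized →
    IsGreedy →
    (IsSubmodularityRatio γ ⊎ IsGreedySubmodularityRatio γ) →
    (IsCurvature α ⊎ IsGreedyCurvature α) →
    0# < γ → γ ≤ 1# → 0# ≤ α → α ≤ 1# →
    ∀ (Ω : Subset n) → ∣ Ω ∣ ≡ K → ∀ t → t ℕ.< K →
    F Ω ≤ α * sumIdx (S t ─ Ω) K + sumIdx (S t ∩ Ω) K
    + γ ⁻¹ * fromℕ (K ℕ.∸ ∣ S t ∩ Ω ∣) * ρseq (suc t)
lemma1 OF n K F j γ α _ _ _ _ normalized greedy ratio curvature 0<γ _ _ _ Ω ∣Ω∣≡K t t<K =
  begin
    F Ω                                 ≤⟨ invariant t ℕP.≤-refl normalized ⟩
    ρ Ω (S t) + W t                     ≤⟨ +-mono-≤ (W t) (residual-bound γ ratio 0<γ) ⟩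
    γ ⁻¹ * (c * r) + W t                ≈⟨ +-comm _ _ ⟩
    W t + γ ⁻¹ * (c * r)                ≈⟨ +-cong W-frozen (sym (*-assoc _ _ _)) ⟩
    α * sumIdx (S t ─ Ω) K + sumIdx (S t ∩ Ω) K + γ ⁻¹ * c * r ∎
  where
  open OrderedField OF
  open OrderedFieldFacts OF
  open Setup OF F K j
  open GreedyBound OF F K j
  open Greedy greedy
  open Target α curvature Ω ∣Ω∣≡K t t<K
  c r : Carrier
  c = fromℕ (K ℕ.∸ ∣ S t ∩ Ω ∣)
  r = ρseq (suc t)
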